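{- Let $q\ge2$ and $n\ge1$ be integers. Under scenario $(*\circ)$, the family $\mathcal{G}_q\cup\mathcal{L}_q$ is $n$-cell implementable if and only if $q\le n$, where $\mathcal{G}_q=\{x\mapsto[\![x\ge t]\!]\}_{t\in[q\rangle}$ and $\mathcal{L}_q=\{x\mapsto[\![x\le t]\!]\}_{t\in[q\rangle}$.
   Context: $[b\rangle=\{0,1,\ldots,b-1\}$. Let $\mathbb{B}=\{0,1\}$, $\mathbb{B}_\circ=\mathbb{B}$, $\mathbb{B}_*=\mathbb{B}\cup\{*\}$, $\mathbb{B}_\bullet=\mathbb{B}\cup\{*,\bullet\}$. Define $\mathrm{T}:\mathbb{B}_\bullet^2\to\mathbb{B}$ by $\mathrm{T}(u,\vartheta)=1$ if and only if $u=*$, or $\vartheta=*$, or $u=\vartheta\in\mathbb{B}$. $[\![\cdot]\!]$ is the Iverson bracket. $\mathcal{F}_q$ is the set of all functions $[q\rangle\to\mathbb{B}$. For $\alpha,\beta\in\{\circ,*,\bullet\}$, a subset $\Phi\subseteq\mathcal{F}_q$ is $n$-cell implementable under scenario $(\alpha\beta)$ if there exist mappings $\mathbf{u}=(u_j)_{j\in[n\rangle}:[q\rangle\to\mathbb{B}_\alpha^n$ and $\boldsymbol{\vartheta}=(\vartheta_j)_{j\in[n\rangle}:\Phi\to\mathbb{B}_\beta^n$ such that $f(x)=\bigwedge_{j\in[n\rangle}\mathrm{T}(u_j(x),\vartheta_j(f))$ for all $f\in\Phi$ and $x\in[q\rangle$. -}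

module Defs where

open import Data.Nat using (ℕ; _≤_; _≥_)
open import Data.Fin using (Fin; toℕ)
import Data.Fin as Fin
open import Data.Bool using (Bool; true; false; _∧_)
open import Data.Product using (Σ; _×_; _,_)
open import Relation.Binary.PropositionalEquality using (_≡_)
open import Relation.Nullary.Decidable using (⌊_⌋)
import Data.Nat as N

data B• : Set where
  b0 b1 star bullet : B•

data Scen : Set where
  ∘ₛ *ₛ •ₛ : Scen

InAlph : Scen → B• → Bool
InAlph ∘ₛ b0 = true
InAlph ∘ₛ b1 = true
InAlph ∘ₛ _  = false
InAlph *ₛ bullet = false
InAlph *ₛ _ = true
InAlph •ₛ _ = true

T : B• → B• → Bool
T star _ = true
T b0 star = true
T b1 star = true
T bullet star = true
T b0 b0 = true
T b1 b1 = true
T _ _ = false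

⋀ : (n : ℕ) → (Fin n → Bool) → Bool
⋀ ℕ.zero _ = true
⋀ (ℕ.suc n) g = g Fin.zero ∧ ⋀ n (λ j → g (Fin.suc j))

-- A family Φ ⊆ 𝓕_q given as an indexed family F : I → 𝓕_q (Φ = image of F).
-- Φ is n-cell implementable under scenario (αβ) iff there are
-- u : [q⟩ → 𝔹_α^n and ϑ : Φ → 𝔹_β^n with f(x) = ⋀_j T(u_j x, ϑ_j f).
-- Since ϑ is a function on Φ (on functions, not indices), ϑ on indices
-- must give equal values to indices denoting the same function.
Implementable : (α β : Scen) (q n : ℕ) {I : Set} (F : I → Fin q → Bool) → Set
Implementable α β q n {I} F =
  Σ (Fin q → Fin n → B•) λ u →
  Σ (I → Fin n → B•) λ ϑ →
    (∀ x j → InAlph α (u x j) ≡ true)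
  × (∀ i j → InAlph β (ϑ i j) ≡ true)
  × (∀ i i' → (∀ x → F i x ≡ F i' x) → ∀ j → ϑ i j ≡ ϑ i' j)
  × (∀ i x → F i x ≡ ⋀ n (λ j → T (u x j) (ϑ i j)))

GL : (q : ℕ) → Bool × Fin q → Fin q → Bool
GL q (true , t) x = ⌊ toℕ t N.≤? toℕ x ⌋
GL q (false , t) x = ⌊ toℕ x N.≤? toℕ t ⌋

{-# OPTIONS --safe #-}
-- A point x is told apart from every smaller point by a member of 𝓖_q ∪ 𝓛_q that
-- rejects x and accepts everything below it, while [[x ≥ 0]] accepts everything.
-- The rejecting cell for x carries, in the two members, two different binary
-- thresholds; a point below x that passes both must therefore hold * there, so
-- rejecting cells of different points differ and there are at least q of them.
-- Conversely, q cells suffice for any family: cell x holds 0 exactly at point x and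
-- * elsewhere, and its threshold stores f(x).
module Submission where

open import Defs
open import Data.Nat using (ℕ; zero; suc; _≤_; _<_; _≤?_; s≤s)
open import Data.Nat.Properties using (≰⇒>; n≮n; _<?_)
open import Data.Fin using (Fin; toℕ; fromℕ<; inject₁; inject≤)
  renaming (zero to fzero; suc to fsuc)
open import Data.Fin.Properties
  using (pigeonhole; toℕ-injective; toℕ-inject₁; toℕ-inject≤; toℕ-fromℕ<; toℕ<n; suc-injective)
  renaming (_≟_ to _≟ᶠ_)
open import Data.Bool using (Bool; true; false; _∧_; if_then_else_)
open import Data.Bool.Properties using (∧-identityʳ)
open import Data.Product using (Σ; _×_; _,_; proj₁; proj₂)
open import Data.Sum using (_⊎_; inj₁; inj₂)
open import Function using (_∘_)
open import Function.Bundles using (_⇔_; mk⇔)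
open import Relation.Nullary using (Dec; ¬_; yes; no; contradiction)
open import Relation.Nullary.Decidable using (⌊_⌋; isYes≗does; dec-true; dec-false)
open import Relation.Binary.PropositionalEquality
  using (_≡_; _≢_; refl; sym; trans; cong; cong₂; subst; module ≡-Reasoning)

⋀-true⁻ : ∀ n g → ⋀ n g ≡ true → ∀ j → g j ≡ true
⋀-true⁻ (suc n) g e fzero    with g fzero
... | true = refl
⋀-true⁻ (suc n) g e (fsuc j) with g fzero
... | true = ⋀-true⁻ n (g ∘ fsuc) e j

⋀-true⁺ : ∀ n g → (∀ j → g j ≡ true) → ⋀ n g ≡ true
⋀-true⁺ zero    g all = refl
⋀-true⁺ (suc n) g all rewrite all fzero = ⋀-true⁺ n (g ∘ fsuc) (all ∘ fsuc)

⋀-false⁻ : ∀ n g → ⋀ n g ≡ false → Σ (Fin n) λ j → g j ≡ false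
⋀-false⁻ (suc n) g e with g fzero in eq
... | false = fzero , eq
... | true  with j , gj ← ⋀-false⁻ n (g ∘ fsuc) e = fsuc j , gj

⋀-single : ∀ n g j₀ → (∀ j → j ≢ j₀ → g j ≡ true) → ⋀ n g ≡ g j₀
⋀-single (suc n) g fzero     others =
  trans (cong (g fzero ∧_) (⋀-true⁺ n (g ∘ fsuc) λ j → others (fsuc j) λ ()))
        (∧-identityʳ (g fzero))
⋀-single (suc n) g (fsuc j₀) others rewrite others fzero (λ ()) =
  ⋀-single n (g ∘ fsuc) j₀ λ j j≢j₀ → others (fsuc j) (j≢j₀ ∘ suc-injective)

T-rejected⇒≢star : ∀ {b c} → T b c ≡ false → b ≢ star
T-rejected⇒≢star () refl

T-accepted⇒star⊎≡ : ∀ {b c} → InAlph ∘ₛ c ≡ true → T b c ≡ true → b ≡ star ⊎ b ≡ c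
T-accepted⇒star⊎≡ {b0}   {b0} _ _ = inj₂ refl
T-accepted⇒star⊎≡ {b1}   {b1} _ _ = inj₂ refl
T-accepted⇒star⊎≡ {star}      _ _ = inj₁ refl

T-accepts-distinct⇒star : ∀ {b c d} → InAlph ∘ₛ c ≡ true → InAlph ∘ₛ d ≡ true → c ≢ d →
                          T b c ≡ true → T b d ≡ true → b ≡ star
T-accepts-distinct⇒star c∈ d∈ c≢d Tbc Tbd
  with T-accepted⇒star⊎≡ c∈ Tbc | T-accepted⇒star⊎≡ d∈ Tbd
... | inj₁ b≡star | _            = b≡star
... | inj₂ _      | inj₁ b≡star  = b≡star
... | inj₂ b≡c    | inj₂ b≡d     = contradiction (trans (sym b≡c) b≡d) c≢d

T-separates : ∀ {a c d} → T a c ≡ true → T a d ≡ false → c ≢ d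
T-separates Tac Tad refl = contradiction (trans (sym Tac) Tad) λ ()

record Staircase {q : ℕ} {I : Set} (F : I → Fin q → Bool) : Set where
  field
    top          : I
    top-accepts  : ∀ x → F top x ≡ true
    reject       : Fin q → I
    reject-at    : ∀ x → F (reject x) x ≡ false
    reject-below : ∀ x y → toℕ y < toℕ x → F (reject x) y ≡ true

module RejectingCells {q n : ℕ} {I : Set} {F : I → Fin q → Bool} (S : Staircase F)
  (u : Fin q → Fin n → B•) (ϑ : I → Fin n → B•)
  (ϑ-binary : ∀ i j → InAlph ∘ₛ (ϑ i j) ≡ true)
  (F≡⋀ : ∀ i x → F i x ≡ ⋀ n (λ j → T (u x j) (ϑ i j))) where
  open Staircase S

  accepts : ∀ i x → F i x ≡ true → ∀ j → T (u x j) (ϑ i j) ≡ true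
  accepts i x Fix = ⋀-true⁻ n _ (trans (sym (F≡⋀ i x)) Fix)

  rejecting : ∀ x → Σ (Fin n) λ j → T (u x j) (ϑ (reject x) j) ≡ false
  rejecting x = ⋀-false⁻ n _ (trans (sym (F≡⋀ (reject x) x)) (reject-at x))

  cell : Fin q → Fin n
  cell = proj₁ ∘ rejecting

  rejects : ∀ x → T (u x (cell x)) (ϑ (reject x) (cell x)) ≡ false
  rejects = proj₂ ∘ rejecting

  star-below : ∀ x y → toℕ y < toℕ x → u y (cell x) ≡ star
  star-below x y y<x =
    T-accepts-distinct⇒star (ϑ-binary top j) (ϑ-binary (reject x) j)
      (T-separates (accepts top x (top-accepts x) j) (rejects x))
      (accepts top y (top-accepts y) j) (accepts (reject x) y (reject-below x y y<x) j)
    where j = cell x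

  cell-injective-on-< : ∀ x x′ → toℕ x < toℕ x′ → cell x ≢ cell x′
  cell-injective-on-< x x′ x<x′ same =
    T-rejected⇒≢star (rejects x) (subst (λ j → u x j ≡ star) (sym same) (star-below x′ x x<x′))

  points≤cells : q ≤ n
  points≤cells with q ≤? n
  ... | yes q≤n = q≤n
  ... | no  q≰n with x , x′ , x<x′ , same ← pigeonhole (≰⇒> q≰n) cell =
    contradiction same (cell-injective-on-< x x′ x<x′)

⌊⌋-yes : ∀ {A : Set} (a? : Dec A) → A → ⌊ a? ⌋ ≡ true
⌊⌋-yes a? a = trans (isYes≗does a?) (dec-true a? a)

⌊⌋-no : ∀ {A : Set} (a? : Dec A) → ¬ A → ⌊ a? ⌋ ≡ false
⌊⌋-no a? ¬a = trans (isYes≗does a?) (dec-false a? ¬a)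

GL-staircase : ∀ {q} → 2 ≤ q → Staircase (GL q)
GL-staircase {suc zero} (s≤s ())
GL-staircase {suc (suc m)} _ = record
  { top          = true , fzero
  ; top-accepts  = λ _ → refl
  ; reject       = reject
  ; reject-at    = reject-at
  ; reject-below = reject-below
  }
  where
  reject : Fin (suc (suc m)) → Bool × Fin (suc (suc m))
  reject fzero    = true , fsuc fzero
  reject (fsuc x) = false , inject₁ x

  reject-at : ∀ x → GL _ (reject x) x ≡ false
  reject-at fzero    = refl
  reject-at (fsuc x) = ⌊⌋-no (suc (toℕ x) ≤? toℕ (inject₁ x))
    λ x<x → n≮n (toℕ x) (subst (suc (toℕ x) ≤_) (toℕ-inject₁ x) x<x)

  reject-below : ∀ x y → toℕ y < toℕ x → GL _ (reject x) y ≡ true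
  reject-below (fsuc x) y (s≤s y≤x) = ⌊⌋-yes (toℕ y ≤? toℕ (inject₁ x))
    (subst (toℕ y ≤_) (sym (toℕ-inject₁ x)) y≤x)

encode : Bool → B•
encode b = if b then b0 else b1

T-b0-encode : ∀ b → T b0 (encode b) ≡ b
T-b0-encode true  = refl
T-b0-encode false = refl

encode-binary : ∀ b → InAlph ∘ₛ (encode b) ≡ true
encode-binary true  = refl
encode-binary false = refl

module OneCellPerPoint {q n : ℕ} {I : Set} (F : I → Fin q → Bool) (q≤n : q ≤ n) where
  cell : Fin q → Fin n
  cell x = inject≤ x q≤n

  u : Fin q → Fin n → B•
  u x j with j ≟ᶠ cell x
  ... | yes _ = b0
  ... | no  _ = star

  ϑ : I → Fin n → B•
  ϑ i j with toℕ j <? q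
  ... | yes j<q = encode (F i (fromℕ< j<q))
  ... | no  _   = b0

  u-starred : ∀ x j → InAlph *ₛ (u x j) ≡ true
  u-starred x j with j ≟ᶠ cell x
  ... | yes _ = refl
  ... | no  _ = refl

  ϑ-binary : ∀ i j → InAlph ∘ₛ (ϑ i j) ≡ true
  ϑ-binary i j with toℕ j <? q
  ... | yes _ = encode-binary _
  ... | no  _ = refl

  ϑ-respects-F : ∀ i i′ → (∀ x → F i x ≡ F i′ x) → ∀ j → ϑ i j ≡ ϑ i′ j
  ϑ-respects-F i i′ F≗ j with toℕ j <? q
  ... | yes _ = cong encode (F≗ _)
  ... | no  _ = refl

  ϑ-at-cell : ∀ i x → ϑ i (cell x) ≡ encode (F i x)
  ϑ-at-cell i x with toℕ (cell x) <? q
  ... | yes j<q = cong (encode ∘ F i) (toℕ-injective (trans (toℕ-fromℕ< j<q) (toℕ-inject≤ x q≤n)))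
  ... | no  j≮q = contradiction (subst (_< q) (sym (toℕ-inject≤ x q≤n)) (toℕ<n x)) j≮q

  u-at-cell : ∀ x → u x (cell x) ≡ b0
  u-at-cell x with cell x ≟ᶠ cell x
  ... | yes _   = refl
  ... | no  x≢x = contradiction refl x≢x

  T-off-cell : ∀ i x j → j ≢ cell x → T (u x j) (ϑ i j) ≡ true
  T-off-cell i x j j≢ with j ≟ᶠ cell x
  ... | yes j≡ = contradiction j≡ j≢
  ... | no  _  = refl

  F≡⋀ : ∀ i x → F i x ≡ ⋀ n (λ j → T (u x j) (ϑ i j))
  F≡⋀ i x = sym (begin
    ⋀ n (λ j → T (u x j) (ϑ i j))      ≡⟨ ⋀-single n _ (cell x) (T-off-cell i x) ⟩
    T (u x (cell x)) (ϑ i (cell x))    ≡⟨ cong₂ T (u-at-cell x) (ϑ-at-cell i x) ⟩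
    T b0 (encode (F i x))              ≡⟨ T-b0-encode (F i x) ⟩
    F i x                              ∎)
    where open ≡-Reasoning

  implementable : Implementable *ₛ ∘ₛ q n F
  implementable = u , ϑ , u-starred , ϑ-binary , ϑ-respects-F , F≡⋀

proposition11 : (q n : ℕ) → 2 ≤ q → 1 ≤ n →
    (Implementable *ₛ ∘ₛ q n (GL q) ⇔ q ≤ n)
proposition11 q n 2≤q _ = mk⇔
  (λ (u , ϑ , _ , ϑ-binary , _ , F≡⋀) →
     RejectingCells.points≤cells (GL-staircase 2≤q) u ϑ ϑ-binary F≡⋀)
  (λ q≤n → OneCellPerPoint.implementable (GL q) q≤n)
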